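{- Let $r$ be a power of $2$. For each odd integer $n>0$ let $A_n\in t\,\mathbb{Z}/2[t^2]$, and suppose that for all odd $n>0$ \[ A_{n+8r}=t^{8r}A_n+t^{2r}A_{n+2r}. \] If for every odd $n<8r^2$, $A_n$ is a sum of monomials preceding $t^n$, then for every odd $n>0$, $A_n$ is a sum of monomials preceding $t^n$.
   Context: $\mathbb{N}=\{0,1,2,\dots\}$. Let $g:\mathbb{N}\to\mathbb{N}$ be defined by $g(0)=0$, $g(2n)=4g(n)$, $g(2n+1)=g(2n)+1$. For $a,b\in\mathbb{N}$, $[a,b]$ denotes the monomial $t^{1+2g(a)+4g(b)}\in\mathbb{Z}/2[t]$; $(a,b)\mapsto[a,b]$ is a bijection from $\mathbb{N}\times\mathbb{N}$ onto the monomials $t^k$, $k$ odd and positive. Say $[c,d]$ precedes (is earlier than) $[a,b]$ if $c+d<a+b$, or $c+d=a+b$ and $d<b$. "A sum of monomials" with some property means a finite sum (possibly empty, i.e. $0$) of distinct monomials with that property. -}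

module Defs where

open import Data.Nat using (ℕ; zero; suc; _+_; _*_; _∸_; _<_; _≤_; _/_; _%_)
open import Data.Nat.Base using (_<ᵇ_)
open import Data.Bool using (Bool; true; false; _xor_; if_then_else_)
open import Data.Product using (Σ; ∃; _×_; _,_)
open import Data.Sum using (_⊎_)
open import Relation.Binary.PropositionalEquality using (_≡_)

Odd : ℕ → Set
Odd n = ∃ λ k → n ≡ 1 + 2 * k

-- g(0)=0, g(2n)=4g(n), g(2n+1)=4g(n)+1, computed with fuel
-- (fuel n suffices for argument n since n / 2 < n for n > 0).
gAux : ℕ → ℕ → ℕ
gAux zero    _ = 0
gAux (suc f) n = 4 * gAux f (n / 2) + n % 2

g : ℕ → ℕ
g n = gAux n n

bracket : ℕ → ℕ → ℕ
bracket a b = 1 + 2 * g a + 4 * g b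

Precedes : ℕ → ℕ → Set
Precedes k n = Σ ℕ λ a → Σ ℕ λ b → Σ ℕ λ c → Σ ℕ λ d →
  (n ≡ bracket a b) × (k ≡ bracket c d) ×
  ((c + d < a + b) ⊎ ((c + d ≡ a + b) × (d < b)))

record Poly : Set where
  field
    coeff  : ℕ → Bool
    finite : ∃ λ N → ∀ m → N ≤ m → coeff m ≡ false
open Poly public

shiftC : ℕ → (ℕ → Bool) → ℕ → Bool
shiftC k c m = if m <ᵇ k then false else c (m ∸ k)

InOddPart : Poly → Set
InOddPart P = ∀ m → coeff P (2 * m) ≡ false

IsShiftSum : Poly → ℕ → Poly → ℕ → Poly → Set
IsShiftSum P a Q b R = ∀ m → coeff P m ≡ (shiftC a (coeff Q) m xor shiftC b (coeff R) m)

SumOfPreceding : Poly → ℕ → Set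
SumOfPreceding P n = ∀ k → coeff P k ≡ true → Precedes k n

-- An odd exponent is 1 + 2 x with x = g a + 2 g b, so (a , b) ↦ x interleaves binary digits.
-- Adding 2^e to x moves (a , b) up by at most δ = (2^k , 0) if e = 2k, or (0 , 2^k) if
-- e = 2k + 1, in the order "a + b first, then b", and by exactly δ when x < 2^e (no carry).
-- Hence for x < 2^e, multiplying t^(1+2x) and a monomial preceding it by t^(2·2^e) keeps the
-- precedence.
-- Squaring the recurrence over Z/2 gives it with r replaced by any S = 2^i r. For odd
-- n = 1 + 2 m with m ≥ 4r pick such an S with 4S ≤ m < 8S and write m = x + 4S; the recurrence
-- at 1 + 2x gives A_n = t^(8S) A_(1+2x) + t^(2S) A_(1+2(x+S)), and by strong induction the
-- carry estimates for 4S and S move the monomials of both terms below t^n.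

module Submission where

open import Defs
open import Data.Bool.Base using (Bool; true; false; _xor_; if_then_else_)
open import Data.Empty using (⊥-elim)
open import Data.Nat.Base using (ℕ; zero; suc; _+_; _*_; _^_; _∸_; _/_; _%_; _≤_; _<_; z≤n; s≤s; _<ᵇ_; >-nonZero)
open import Data.Nat.DivMod using (m*n/n≡m; [m+kn]%n≡m%n; +-distrib-/; m/n<m; /-monoˡ-≤)
open import Data.Nat.Induction using (<-rec)
open import Data.Nat.Properties
open import Data.Nat.Tactic.RingSolver using (solve-∀)
open import Data.Product using (_×_; _,_; ∃; ∃₂; proj₁; proj₂)
open import Data.Sum using (_⊎_; inj₁; inj₂)
open import Algebra.Properties.CommutativeSemigroup +-commutativeSemigroup
  using () renaming (interchange to +-interchange)
open import Relation.Binary.PropositionalEquality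
  using (_≡_; _≗_; _→-setoid_; refl; sym; trans; cong; cong₂; subst; subst₂; module ≡-Reasoning)
open import Relation.Nullary using (yes; no)
open import Relation.Nullary.Reflects using (ofʸ; ofⁿ)

-- Binary digits and g

bit : Bool → ℕ
bit false = 0
bit true  = 1

bit-injective : ∀ {e e'} → bit e ≡ bit e' → e ≡ e'
bit-injective {false} {false} _ = refl
bit-injective {true}  {true}  _ = refl

data Bits : ℕ → Set where
  _+2*_ : (e : Bool) (h : ℕ) → Bits (bit e + 2 * h)

bits : ∀ n → Bits n
bits zero = false +2* 0
bits (suc n) with bits n
... | false +2* h = true +2* h
... | true  +2* h = subst Bits (cong suc (+-suc h (h + 0))) (false +2* suc h)

bit-%2 : ∀ e → bit e % 2 ≡ bit e
bit-%2 false = refl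
bit-%2 true  = refl

bit-/2 : ∀ e → bit e / 2 ≡ 0
bit-/2 false = refl
bit-/2 true  = refl

bits-%2 : ∀ e h → (bit e + 2 * h) % 2 ≡ bit e
bits-%2 e h = begin
  (bit e + 2 * h) % 2  ≡⟨ cong (λ k → (bit e + k) % 2) (*-comm 2 h) ⟩
  (bit e + h * 2) % 2  ≡⟨ [m+kn]%n≡m%n (bit e) h 2 ⟩
  bit e % 2            ≡⟨ bit-%2 e ⟩
  bit e                ∎
  where open ≡-Reasoning

bits-/2 : ∀ e h → (bit e + 2 * h) / 2 ≡ h
bits-/2 e h = begin
  (bit e + 2 * h) / 2    ≡⟨ +-distrib-/ (bit e) (2 * h) no-carry ⟩
  bit e / 2 + 2 * h / 2  ≡⟨ cong₂ _+_ (bit-/2 e) (trans (cong (_/ 2) (*-comm 2 h)) (m*n/n≡m h 2)) ⟩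
  h                      ∎
  where
  open ≡-Reasoning
  no-carry : bit e % 2 + 2 * h % 2 < 2
  no-carry rewrite bit-%2 e | bits-%2 false h | +-identityʳ (bit e) = bit<2 e
    where
    bit<2 : ∀ e → bit e < 2
    bit<2 false = s≤s z≤n
    bit<2 true  = s≤s (s≤s z≤n)

bits-injective : ∀ e e' {h h'} → bit e + 2 * h ≡ bit e' + 2 * h' → e ≡ e' × h ≡ h'
bits-injective e e' {h} {h'} eq =
  bit-injective (trans (sym (bits-%2 e h)) (trans (cong (_% 2) eq) (bits-%2 e' h'))) ,
  trans (sym (bits-/2 e h)) (trans (cong (_/ 2) eq) (bits-/2 e' h'))

gAux-zero : ∀ f → gAux f 0 ≡ 0
gAux-zero zero    = refl
gAux-zero (suc f) = cong (λ k → 4 * k + 0) (gAux-zero f)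

half-≤ : ∀ {n f} → n ≤ suc f → n / 2 ≤ f
half-≤ {n} {f} n≤1+f = ≤-pred (≤-<-trans (/-monoˡ-≤ 2 n≤1+f) (m/n<m (suc f) 2 (s≤s (s≤s z≤n))))

gAux-fuel : ∀ {f f' n} → n ≤ f → n ≤ f' → gAux f n ≡ gAux f' n
gAux-fuel {zero}  {f'}     z≤n _   = sym (gAux-zero f')
gAux-fuel {suc f} {zero}   _   z≤n = gAux-zero (suc f)
gAux-fuel {suc f} {suc f'} {n} p q = cong (λ k → 4 * k + n % 2) (gAux-fuel (half-≤ p) (half-≤ q))

g-half : ∀ n → g n ≡ 4 * g (n / 2) + n % 2
g-half zero    = refl
g-half (suc n) = cong (λ k → 4 * k + suc n % 2) (gAux-fuel {n} {suc n / 2} (half-≤ ≤-refl) ≤-refl)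

g-bits : ∀ e h → g (bit e + 2 * h) ≡ bit e + 4 * g h
g-bits e h = begin
  g (bit e + 2 * h)
    ≡⟨ g-half (bit e + 2 * h) ⟩
  4 * g ((bit e + 2 * h) / 2) + (bit e + 2 * h) % 2
    ≡⟨ cong₂ (λ k l → 4 * g k + l) (bits-/2 e h) (bits-%2 e h) ⟩
  4 * g h + bit e
    ≡⟨ +-comm (4 * g h) (bit e) ⟩
  bit e + 4 * g h ∎
  where open ≡-Reasoning

g-inflationary : ∀ n → n ≤ g n
g-inflationary = <-rec _ inflate
  where
  inflate : ∀ n → (∀ {m} → m < n → m ≤ g m) → n ≤ g n
  inflate n ih with bits n
  ... | e +2* zero  = ≤-reflexive (sym (g-bits e 0))
  ... | e +2* suc h = subst (bit e + 2 * suc h ≤_) (sym (g-bits e (suc h)))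
    (+-monoʳ-≤ (bit e) (≤-trans (*-monoˡ-≤ (suc h) {2} {4} (s≤s (s≤s z≤n))) (*-monoʳ-≤ 4 (ih h<n))))
    where
    h<n : suc h < bit e + 2 * suc h
    h<n = <-≤-trans (m<m+n (suc h) (s≤s z≤n)) (m≤n+m (2 * suc h) (bit e))

-- Pairs, their interleaving, and the order

infixl 6 _⊕_
infix  4 _≺_ _≼_

_⊕_ : ℕ × ℕ → ℕ × ℕ → ℕ × ℕ
(a , b) ⊕ (c , d) = a + c , b + d

double : ℕ × ℕ → ℕ × ℕ
double (a , b) = 2 * a , 2 * b

-- Interleaves the binary digits of a (even places) and b (odd places): bracket a b ≡ 1 + 2 * encode (a , b).
encode : ℕ × ℕ → ℕ
encode (a , b) = g a + 2 * g b

bracket-encode : ∀ a b → bracket a b ≡ 1 + 2 * encode (a , b)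
bracket-encode a b = lemma (g a) (g b)
  where
  lemma : ∀ u v → 1 + 2 * u + 4 * v ≡ 1 + 2 * (u + 2 * v)
  lemma = solve-∀

encode-bits : ∀ e f a b →
  encode (bit e + 2 * a , bit f + 2 * b) ≡ bit e + 2 * (bit f + 2 * encode (a , b))
encode-bits e f a b = begin
  g (bit e + 2 * a) + 2 * g (bit f + 2 * b)  ≡⟨ cong₂ (λ u v → u + 2 * v) (g-bits e a) (g-bits f b) ⟩
  bit e + 4 * g a + 2 * (bit f + 4 * g b)    ≡⟨ lemma (bit e) (bit f) (g a) (g b) ⟩
  bit e + 2 * (bit f + 2 * (g a + 2 * g b))  ∎
  where
  open ≡-Reasoning
  lemma : ∀ x y u v → x + 4 * u + 2 * (y + 4 * v) ≡ x + 2 * (y + 2 * (u + 2 * v))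
  lemma = solve-∀

encode-zero : ∀ {p} → encode p ≡ 0 → p ≡ (0 , 0)
encode-zero {a , b} eq = cong₂ _,_ (vanish a (m+n≡0⇒m≡0 (g a) eq))
                                    (vanish b (m+n≡0⇒m≡0 (g b) (m+n≡0⇒n≡0 (g a) eq)))
  where
  vanish : ∀ n → g n ≡ 0 → n ≡ 0
  vanish n gn≡0 = n≤0⇒n≡0 (subst (n ≤_) gn≡0 (g-inflationary n))

digits-≥ : ∀ e f y → 4 * y ≤ bit e + 2 * (bit f + 2 * y)
digits-≥ e f y = begin
  4 * y                            ≡⟨ *-assoc 2 2 y ⟩
  2 * (2 * y)                      ≤⟨ *-monoʳ-≤ 2 (m≤n+m (2 * y) (bit f)) ⟩
  2 * (bit f + 2 * y)              ≤⟨ m≤n+m _ (bit e) ⟩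
  bit e + 2 * (bit f + 2 * y)      ∎
  where open ≤-Reasoning

digits-< : ∀ e f y → 0 < bit e + 2 * (bit f + 2 * y) → y < bit e + 2 * (bit f + 2 * y)
digits-< e f zero    pos = pos
digits-< e f (suc y) _   = <-≤-trans (m<m+n (suc y) (s≤s z≤n)) (digits-≥ e f (suc y))

encode-injective : ∀ {p q} → encode p ≡ encode q → p ≡ q
encode-injective {p} {q} eq = <-rec Unique unique (encode q) p q eq refl
  where
  Unique : ℕ → Set
  Unique x = ∀ p q → encode p ≡ x → encode q ≡ x → p ≡ q
  unique : ∀ x → (∀ {y} → y < x → Unique y) → Unique x
  unique zero    _  p q ep eq = trans (encode-zero ep) (sym (encode-zero eq))
  unique (suc x) ih (a , b) (c , d) ep eq with bits a | bits b | bits c | bits d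
  ... | e +2* a₁ | f +2* b₁ | e' +2* c₁ | f' +2* d₁
    with bits-injective e e'
           (trans (sym (encode-bits e f a₁ b₁)) (trans ep (trans (sym eq) (encode-bits e' f' c₁ d₁))))
  ... | refl , low with bits-injective f f' low
  ... | refl , rest with ih y<x (a₁ , b₁) (c₁ , d₁) refl (sym rest)
    where
    x≡ : suc x ≡ bit e + 2 * (bit f + 2 * encode (a₁ , b₁))
    x≡ = trans (sym ep) (encode-bits e f a₁ b₁)
    y<x : encode (a₁ , b₁) < suc x
    y<x = subst (encode (a₁ , b₁) <_) (sym x≡) (digits-< e f _ (subst (0 <_) x≡ (s≤s z≤n)))
  ... | refl = refl

data Lex (_R_ : ℕ → ℕ → Set) : ℕ × ℕ → ℕ × ℕ → Set where
  sum-< : ∀ {a b c d} → a + b < c + d → Lex _R_ (a , b) (c , d)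
  sum-≡ : ∀ {a b c d} → a + b ≡ c + d → b R d → Lex _R_ (a , b) (c , d)

_≺_ : ℕ × ℕ → ℕ × ℕ → Set
_≺_ = Lex _<_

_≼_ : ℕ × ℕ → ℕ × ℕ → Set
_≼_ = Lex _≤_

≼-reflexive : ∀ {p q} → p ≡ q → p ≼ q
≼-reflexive refl = sum-≡ refl ≤-refl

lex-trans : ∀ {R₁ R₂ R₃ : ℕ → ℕ → Set} → (∀ {i j k} → R₁ i j → R₂ j k → R₃ i k) →
  ∀ {p q r} → Lex R₁ p q → Lex R₂ q r → Lex R₃ p r
lex-trans _  (sum-< s<s')       (sum-< s'<s'')       = sum-< (<-trans s<s' s'<s'')
lex-trans _  (sum-< s<s')       (sum-≡ s'≡s'' _)     = sum-< (<-≤-trans s<s' (≤-reflexive s'≡s''))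
lex-trans _  (sum-≡ s≡s' _)     (sum-< s'<s'')       = sum-< (≤-<-trans (≤-reflexive s≡s') s'<s'')
lex-trans tr (sum-≡ s≡s' t)     (sum-≡ s'≡s'' t')    = sum-≡ (trans s≡s' s'≡s'') (tr t t')

≼-trans : ∀ {p q r} → p ≼ q → q ≼ r → p ≼ r
≼-trans = lex-trans ≤-trans

≼-≺-trans : ∀ {p q r} → p ≼ q → q ≺ r → p ≺ r
≼-≺-trans = lex-trans ≤-<-trans

≺-≼-trans : ∀ {p q r} → p ≺ q → q ≼ r → p ≺ r
≺-≼-trans = lex-trans <-≤-trans

lex-⊕ʳ : ∀ {_R_ : ℕ → ℕ → Set} → (∀ y {t t'} → t R t' → (t + y) R (t' + y)) →
  ∀ {p q} r → Lex _R_ p q → Lex _R_ (p ⊕ r) (q ⊕ r)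
lex-⊕ʳ _    {a , b} {c , d} (x , y) (sum-< s<s') =
  sum-< (subst₂ _<_ (+-interchange a b x y) (+-interchange c d x y) (+-monoˡ-< (x + y) s<s'))
lex-⊕ʳ mono {a , b} {c , d} (x , y) (sum-≡ s≡s' t) =
  sum-≡ (trans (sym (+-interchange a b x y)) (trans (cong (_+ (x + y)) s≡s') (+-interchange c d x y))) (mono y t)

⊕-monoʳ-≺ : ∀ {p q} r → p ≺ q → p ⊕ r ≺ q ⊕ r
⊕-monoʳ-≺ = lex-⊕ʳ +-monoˡ-<

⊕-monoʳ-≼ : ∀ {p q} r → p ≼ q → p ⊕ r ≼ q ⊕ r
⊕-monoʳ-≼ = lex-⊕ʳ +-monoˡ-≤

⊕-comm : ∀ p q → p ⊕ q ≡ q ⊕ p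
⊕-comm (a , b) (c , d) = cong₂ _,_ (+-comm a c) (+-comm b d)

⊕-monoˡ-≼ : ∀ o {p q} → p ≼ q → o ⊕ p ≼ o ⊕ q
⊕-monoˡ-≼ o {p} {q} p≼q = subst₂ _≼_ (⊕-comm p o) (⊕-comm q o) (⊕-monoʳ-≼ o p≼q)

double-mono-≼ : ∀ {p q} → p ≼ q → double p ≼ double q
double-mono-≼ {a , b} {c , d} (sum-< s<s') =
  sum-< (subst₂ _<_ (*-distribˡ-+ 2 a b) (*-distribˡ-+ 2 c d) (*-monoʳ-< 2 s<s'))
double-mono-≼ {a , b} {c , d} (sum-≡ s≡s' t≤t') =
  sum-≡ (trans (sym (*-distribˡ-+ 2 a b)) (trans (cong (2 *_) s≡s') (*-distribˡ-+ 2 c d))) (*-monoʳ-≤ 2 t≤t')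

⊕-double-distrib : ∀ o p δ → o ⊕ double (p ⊕ δ) ≡ (o ⊕ double p) ⊕ double δ
⊕-double-distrib (x , y) (a , b) (c , d) = cong₂ _,_ (lemma x a c) (lemma y b d)
  where
  lemma : ∀ x a c → x + 2 * (a + c) ≡ x + 2 * a + 2 * c
  lemma = solve-∀

⊕-twice : ∀ p δ → (p ⊕ δ) ⊕ δ ≡ p ⊕ double δ
⊕-twice (a , b) (c , d) = cong₂ _,_ (lemma a c) (lemma b d)
  where
  lemma : ∀ a c → a + c + c ≡ a + 2 * c
  lemma = solve-∀

-- Carries

-- Adding u to the index moves the pair up by at most δ, and by exactly δ when there is no carry.
CarryFrom : ℕ → ℕ × ℕ → ℕ × ℕ → Set
CarryFrom u δ p = ∃ λ q → encode q ≡ encode p + u × q ≼ p ⊕ δ × (encode p < u → q ≡ p ⊕ δ)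

Carry : ℕ → ℕ × ℕ → Set
Carry u δ = ∀ p → CarryFrom u δ p

carry-1 : Carry 1 (1 , 0)
carry-1 (a , b) = <-rec (λ a → ∀ b → CarryFrom 1 (1 , 0) (a , b)) carry a b
  where
  odd-index : ∀ f a b → 1 ≤ encode (1 + 2 * a , bit f + 2 * b)
  odd-index f a b = subst (1 ≤_) (sym (encode-bits true f a b)) (s≤s z≤n)

  carry : ∀ a → (∀ {a'} → a' < a → ∀ b → CarryFrom 1 (1 , 0) (a' , b)) →
          ∀ b → CarryFrom 1 (1 , 0) (a , b)
  carry a ih b with bits a | bits b
  ... | false +2* a₁ | f +2* b₁ = (1 + 2 * a₁ , bit f + 2 * b₁) , index , ≼-reflexive q≡ , λ _ → q≡
    where
    index : encode (1 + 2 * a₁ , bit f + 2 * b₁) ≡ encode (2 * a₁ , bit f + 2 * b₁) + 1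
    index = trans (encode-bits true f a₁ b₁)
              (trans (+-comm 1 _) (cong (_+ 1) (sym (encode-bits false f a₁ b₁))))
    q≡ : (1 + 2 * a₁ , bit f + 2 * b₁) ≡ (2 * a₁ , bit f + 2 * b₁) ⊕ (1 , 0)
    q≡ = cong₂ _,_ (+-comm 1 (2 * a₁)) (sym (+-identityʳ _))
  ... | true +2* a₁ | false +2* b₁ =
    (2 * a₁ , 1 + 2 * b₁) , index , sum-< (≤-reflexive (sums a₁ b₁)) ,
    λ lt → ⊥-elim (<⇒≱ lt (odd-index false a₁ b₁))
    where
    index : encode (2 * a₁ , 1 + 2 * b₁) ≡ encode (1 + 2 * a₁ , 2 * b₁) + 1
    index = trans (encode-bits false true a₁ b₁)
              (trans (lemma (encode (a₁ , b₁))) (cong (_+ 1) (sym (encode-bits true false a₁ b₁))))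
      where
      lemma : ∀ y → 2 * (1 + 2 * y) ≡ 1 + 2 * (2 * y) + 1
      lemma = solve-∀
    sums : ∀ a₁ b₁ → suc (2 * a₁ + (1 + 2 * b₁)) ≡ 1 + 2 * a₁ + 1 + (2 * b₁ + 0)
    sums = solve-∀
  ... | true +2* a₁ | true +2* b₁ with ih (s≤s (m≤m+n a₁ (a₁ + 0))) b₁
  ...   | (c , d) , index₁ , bound₁ , _ =
    double (c , d) , index , ≼-trans (double-mono-≼ bound₁) (sum-< (≤-reflexive (sums a₁ b₁))) ,
    λ lt → ⊥-elim (<⇒≱ lt (odd-index true a₁ b₁))
    where
    index : encode (2 * c , 2 * d) ≡ encode (1 + 2 * a₁ , 1 + 2 * b₁) + 1
    index = trans (encode-bits false false c d)
              (trans (cong (λ z → 2 * (2 * z)) index₁)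
                (trans (lemma (encode (a₁ , b₁))) (cong (_+ 1) (sym (encode-bits true true a₁ b₁)))))
      where
      lemma : ∀ y → 2 * (2 * (y + 1)) ≡ 1 + 2 * (1 + 2 * y) + 1
      lemma = solve-∀
    sums : ∀ a₁ b₁ → suc (2 * (a₁ + 1) + 2 * (b₁ + 0)) ≡ 1 + 2 * a₁ + 1 + (1 + 2 * b₁ + 0)
    sums = solve-∀

carry-2 : Carry 2 (0 , 1)
carry-2 (a , b) with bits a | bits b
... | e +2* a₁ | false +2* b₁ = (bit e + 2 * a₁ , 1 + 2 * b₁) , index , ≼-reflexive q≡ , λ _ → q≡
  where
  index : encode (bit e + 2 * a₁ , 1 + 2 * b₁) ≡ encode (bit e + 2 * a₁ , 2 * b₁) + 2
  index = trans (encode-bits e true a₁ b₁)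
            (trans (lemma (bit e) (encode (a₁ , b₁))) (cong (_+ 2) (sym (encode-bits e false a₁ b₁))))
    where
    lemma : ∀ x y → x + 2 * (1 + 2 * y) ≡ x + 2 * (2 * y) + 2
    lemma = solve-∀
  q≡ : (bit e + 2 * a₁ , 1 + 2 * b₁) ≡ (bit e + 2 * a₁ , 2 * b₁) ⊕ (0 , 1)
  q≡ = cong₂ _,_ (sym (+-identityʳ _)) (+-comm 1 (2 * b₁))
... | e +2* a₁ | true +2* b₁ with carry-1 (a₁ , b₁)
...   | (c , d) , index₁ , bound₁ , _ =
  (bit e + 2 * c , 2 * d) , index , ≼-trans (⊕-monoˡ-≼ (bit e , 0) (double-mono-≼ bound₁)) bound ,
  λ lt → ⊥-elim (<⇒≱ lt two≤)
  where
  index : encode (bit e + 2 * c , 2 * d) ≡ encode (bit e + 2 * a₁ , 1 + 2 * b₁) + 2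
  index = trans (encode-bits e false c d)
            (trans (cong (λ z → bit e + 2 * (2 * z)) index₁)
              (trans (lemma (bit e) (encode (a₁ , b₁))) (cong (_+ 2) (sym (encode-bits e true a₁ b₁)))))
    where
    lemma : ∀ x y → x + 2 * (2 * (y + 1)) ≡ x + 2 * (1 + 2 * y) + 2
    lemma = solve-∀
  bound : (bit e + 2 * (a₁ + 1) , 2 * (b₁ + 0)) ≼ (bit e + 2 * a₁ + 0 , 1 + 2 * b₁ + 1)
  bound = sum-≡ (sums (bit e) a₁ b₁) (≤-trans (m≤m+n _ 2) (≤-reflexive (seconds b₁)))
    where
    sums : ∀ x a₁ b₁ → x + 2 * (a₁ + 1) + 2 * (b₁ + 0) ≡ x + 2 * a₁ + 0 + (1 + 2 * b₁ + 1)
    sums = solve-∀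
    seconds : ∀ b₁ → 2 * (b₁ + 0) + 2 ≡ 1 + 2 * b₁ + 1
    seconds = solve-∀
  two≤ : 2 ≤ encode (bit e + 2 * a₁ , 1 + 2 * b₁)
  two≤ = subst (2 ≤_) (sym (encode-bits e true a₁ b₁))
           (≤-trans (*-monoʳ-≤ 2 (s≤s z≤n)) (m≤n+m _ (bit e)))

carry-quadruple : ∀ {u δ} → Carry u δ → Carry (4 * u) (double δ)
carry-quadruple {u} {δ} carry (a , b) with bits a | bits b
... | e +2* a₁ | f +2* b₁ with carry (a₁ , b₁)
...   | q , index₁ , bound₁ , exact₁ = low ⊕ double q , index , bound , exact
  where
  low : ℕ × ℕ
  low = bit e , bit f

  index : encode (low ⊕ double q) ≡ encode (low ⊕ double (a₁ , b₁)) + 4 * u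
  index = begin
    encode (low ⊕ double q)                          ≡⟨ encode-bits e f (proj₁ q) (proj₂ q) ⟩
    bit e + 2 * (bit f + 2 * encode q)               ≡⟨ cong (λ z → bit e + 2 * (bit f + 2 * z)) index₁ ⟩
    bit e + 2 * (bit f + 2 * (encode (a₁ , b₁) + u)) ≡⟨ lemma (bit e) (bit f) (encode (a₁ , b₁)) u ⟩
    bit e + 2 * (bit f + 2 * encode (a₁ , b₁)) + 4 * u ≡⟨ cong (_+ 4 * u) (encode-bits e f a₁ b₁) ⟨
    encode (low ⊕ double (a₁ , b₁)) + 4 * u          ∎
    where
    open ≡-Reasoning
    lemma : ∀ x y z u → x + 2 * (y + 2 * (z + u)) ≡ x + 2 * (y + 2 * z) + 4 * u
    lemma = solve-∀

  bound : low ⊕ double q ≼ low ⊕ double (a₁ , b₁) ⊕ double δ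
  bound = subst (low ⊕ double q ≼_) (⊕-double-distrib low (a₁ , b₁) δ)
            (⊕-monoˡ-≼ low (double-mono-≼ bound₁))

  exact : encode (low ⊕ double (a₁ , b₁)) < 4 * u → low ⊕ double q ≡ low ⊕ double (a₁ , b₁) ⊕ double δ
  exact lt = trans (cong (λ r → low ⊕ double r) (exact₁ no-carry)) (⊕-double-distrib low (a₁ , b₁) δ)
    where
    no-carry : encode (a₁ , b₁) < u
    no-carry = *-cancelˡ-< 4 _ _
      (≤-<-trans (digits-≥ e f (encode (a₁ , b₁))) (subst (_< 4 * u) (encode-bits e f a₁ b₁) lt))

carry-pow : ∀ e → ∃ λ δ → Carry (2 ^ e) δ
carry-pow 0 = (1 , 0) , carry-1
carry-pow 1 = (0 , 1) , carry-2
carry-pow (suc (suc e)) with carry-pow e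
... | δ , carry = double δ , subst (λ u → Carry u (double δ)) (*-assoc 2 2 (2 ^ e)) (carry-quadruple carry)

encode-surjective : ∀ x → ∃ λ p → encode p ≡ x
encode-surjective zero = (0 , 0) , refl
encode-surjective (suc x) with encode-surjective x
... | p , refl with carry-1 p
...   | q , index , _ = q , trans index (+-comm (encode p) 1)

odd-injective : ∀ {x y} → 1 + 2 * x ≡ 1 + 2 * y → x ≡ y
odd-injective {x} {y} eq = *-cancelˡ-≡ x y 2 (suc-injective eq)

odd-+ : ∀ x u → 1 + 2 * (x + u) ≡ 1 + 2 * x + 2 * u
odd-+ = solve-∀

precedes : ∀ {p q} → q ≺ p → Precedes (1 + 2 * encode q) (1 + 2 * encode p)
precedes {a , b} {c , d} q≺p = a , b , c , d , sym (bracket-encode a b) , sym (bracket-encode c d) , lex q≺p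
  where
  lex : ∀ {a b c d} → (c , d) ≺ (a , b) → (c + d < a + b) ⊎ ((c + d ≡ a + b) × (d < b))
  lex (sum-< s<s')     = inj₁ s<s'
  lex (sum-≡ s≡s' t<t') = inj₂ (s≡s' , t<t')

precedes⁻¹ : ∀ {k x} → Precedes k (1 + 2 * x) →
  ∃₂ λ p q → encode p ≡ x × k ≡ 1 + 2 * encode q × q ≺ p
precedes⁻¹ (a , b , c , d , n≡ , k≡ , order) =
  (a , b) , (c , d) , sym (odd-injective (trans n≡ (bracket-encode a b))) , trans k≡ (bracket-encode c d) , lex order
  where
  lex : ∀ {a b c d} → (c + d < a + b) ⊎ ((c + d ≡ a + b) × (d < b)) → (c , d) ≺ (a , b)
  lex (inj₁ s<s')          = sum-< s<s'
  lex (inj₂ (s≡s' , t<t')) = sum-≡ s≡s' t<t'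

precedes-carry : ∀ {u δ k x} → Carry u δ → x < u →
  Precedes k (1 + 2 * x) → Precedes (k + 2 * u) (1 + 2 * (x + u))
precedes-carry {u} {δ} {k} {x} carry x<u prec with precedes⁻¹ {k} {x} prec
... | p , q , refl , refl , q≺p with carry p | carry q
... | p' , index-p , _ , exact | q' , index-q , q'≼ , _ with exact x<u
... | refl = subst₂ Precedes (trans (cong (λ y → 1 + 2 * y) index-q) (odd-+ (encode q) u))
                            (cong (λ y → 1 + 2 * y) index-p)
                            (precedes (≼-≺-trans q'≼ (⊕-monoʳ-≺ δ q≺p)))

precedes-carry-quadruple : ∀ {u δ k x} → Carry u δ → Carry (4 * u) (double δ) → x < 4 * u →
  Precedes k (1 + 2 * (x + u)) → Precedes (k + 2 * u) (1 + 2 * (x + 4 * u))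
precedes-carry-quadruple {u} {δ} {k} {x} carry carry₄ x<4u prec
  with precedes⁻¹ {k} {x + u} prec | encode-surjective x
... | p , q , index-p , refl , q≺p | p₀ , refl with carry p₀ | carry₄ p₀ | carry q
... | p₁ , index-p₁ , p₁≼ , _ | p₂ , index-p₂ , _ , exact | q' , index-q , q'≼ , _
  with encode-injective {p₁} {p} (trans index-p₁ (sym index-p)) | exact x<4u
... | refl | refl =
  subst₂ Precedes (trans (cong (λ y → 1 + 2 * y) index-q) (odd-+ (encode q) u))
                  (cong (λ y → 1 + 2 * y) index-p₂)
                  (precedes (≼-≺-trans q'≼ (≺-≼-trans (⊕-monoʳ-≺ δ q≺p) p⊕δ≼)))
  where
  p⊕δ≼ : p₁ ⊕ δ ≼ p₀ ⊕ double δ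
  p⊕δ≼ = subst (p₁ ⊕ δ ≼_) (⊕-twice p₀ δ) (⊕-monoʳ-≼ δ p₁≼)

-- Shifted sums over Z/2

infixl 6 _⊻_

_⊻_ : (ℕ → Bool) → (ℕ → Bool) → ℕ → Bool
(f ⊻ h) m = f m xor h m

⊻-cong : ∀ {f f' h h'} → f ≗ f' → h ≗ h' → f ⊻ h ≗ f' ⊻ h'
⊻-cong f≗f' h≗h' m = cong₂ _xor_ (f≗f' m) (h≗h' m)

⊻-cancel-middle : ∀ f h k → (f ⊻ h) ⊻ (h ⊻ k) ≗ f ⊻ k
⊻-cancel-middle f h k m with f m | h m | k m
... | true  | true  | true  = refl
... | true  | true  | false = refl
... | true  | false | _     = refl
... | false | true  | true  = refl
... | false | true  | false = refl
... | false | false | _     = refl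

shiftC-< : ∀ {k m} c → m < k → shiftC k c m ≡ false
shiftC-< {k} {m} c m<k with m <ᵇ k | <ᵇ-reflects-< m k
... | true  | _        = refl
... | false | ofⁿ m≮k = ⊥-elim (m≮k m<k)

shiftC-≥ : ∀ {k m} c → k ≤ m → shiftC k c m ≡ c (m ∸ k)
shiftC-≥ {k} {m} c k≤m with m <ᵇ k | <ᵇ-reflects-< m k
... | true  | ofʸ m<k = ⊥-elim (<⇒≱ m<k k≤m)
... | false | _       = refl

shiftC-true : ∀ k c {m} → shiftC k c m ≡ true → k ≤ m × c (m ∸ k) ≡ true
shiftC-true k c {m} eq with m <ᵇ k | <ᵇ-reflects-< m k
... | false | ofⁿ m≮k = ≮⇒≥ m≮k , eq

shiftC-cong : ∀ k {f h} → f ≗ h → shiftC k f ≗ shiftC k h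
shiftC-cong k f≗h m = cong (if m <ᵇ k then false else_) (f≗h (m ∸ k))

shiftC-⊻ : ∀ k f h → shiftC k (f ⊻ h) ≗ shiftC k f ⊻ shiftC k h
shiftC-⊻ k f h m with m <ᵇ k
... | true  = refl
... | false = refl

shiftC-shiftC : ∀ k l f → shiftC k (shiftC l f) ≗ shiftC (l + k) f
shiftC-shiftC k l f m with m <? k
... | yes m<k = trans (shiftC-< (shiftC l f) m<k) (sym (shiftC-< f (<-≤-trans m<k (m≤n+m k l))))
... | no m≮k with m ∸ k <? l
...   | yes m∸k<l = begin
  shiftC k (shiftC l f) m  ≡⟨ shiftC-≥ (shiftC l f) (≮⇒≥ m≮k) ⟩
  shiftC l f (m ∸ k)       ≡⟨ shiftC-< f m∸k<l ⟩
  false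
    ≡⟨ shiftC-< f (subst (_< l + k) (m∸n+n≡m (≮⇒≥ m≮k)) (+-monoˡ-< k m∸k<l)) ⟨
  shiftC (l + k) f m       ∎
  where open ≡-Reasoning
...   | no m∸k≮l = begin
  shiftC k (shiftC l f) m  ≡⟨ shiftC-≥ (shiftC l f) (≮⇒≥ m≮k) ⟩
  shiftC l f (m ∸ k)       ≡⟨ shiftC-≥ f (≮⇒≥ m∸k≮l) ⟩
  f (m ∸ k ∸ l)            ≡⟨ cong f (trans (∸-+-assoc m k l) (cong (m ∸_) (+-comm k l))) ⟩
  f (m ∸ (l + k))
    ≡⟨ shiftC-≥ f (subst (l + k ≤_) (m∸n+n≡m (≮⇒≥ m≮k)) (+-monoˡ-≤ k (≮⇒≥ m∸k≮l))) ⟨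
  shiftC (l + k) f m       ∎
  where open ≡-Reasoning

shiftSum-true : ∀ P a Q b R → IsShiftSum P a Q b R → ∀ {m} → coeff P m ≡ true →
  (a ≤ m × coeff Q (m ∸ a) ≡ true) ⊎ (b ≤ m × coeff R (m ∸ b) ≡ true)
shiftSum-true P a Q b R P≗ {m} P∋m with shiftC a (coeff Q) m in Q∋ | trans (sym (P≗ m)) P∋m
... | true  | _  = inj₁ (shiftC-true a (coeff Q) Q∋)
... | false | R∋ = inj₂ (shiftC-true b (coeff R) R∋)

Recurrence : (ℕ → Poly) → ℕ → Set
Recurrence A S = ∀ n → Odd n → IsShiftSum (A (n + 8 * S)) (8 * S) (A n) (2 * S) (A (n + 2 * S))

odd-+-even : ∀ {n} t → Odd n → Odd (n + 2 * t)
odd-+-even t (k , refl) = k + t , lemma k t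
  where
  lemma : ∀ k t → 1 + 2 * k + 2 * t ≡ 1 + 2 * (k + t)
  lemma = solve-∀

-- Over Z/2 the two cross terms t^(a+b) y cancel.
shiftSum-square : ∀ a b {p q r x y z : ℕ → Bool} →
  p ≗ shiftC a q ⊻ shiftC b r → q ≗ shiftC a x ⊻ shiftC b y → r ≗ shiftC a y ⊻ shiftC b z →
  p ≗ shiftC (a + a) x ⊻ shiftC (b + b) z
shiftSum-square a b {p} {q} {r} {x} {y} {z} p≗ q≗ r≗ = begin
  p
    ≈⟨ p≗ ⟩
  T a q ⊻ T b r
    ≈⟨ ⊻-cong (shiftC-cong a q≗) (shiftC-cong b r≗) ⟩
  T a (T a x ⊻ T b y) ⊻ T b (T a y ⊻ T b z)
    ≈⟨ ⊻-cong (shiftC-⊻ a (T a x) (T b y)) (shiftC-⊻ b (T a y) (T b z)) ⟩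
  (T a (T a x) ⊻ T a (T b y)) ⊻ (T b (T a y) ⊻ T b (T b z))
    ≈⟨ ⊻-cong (⊻-cong (shiftC-shiftC a a x) (shiftC-shiftC a b y))
              (⊻-cong (λ m → trans (shiftC-shiftC b a y m) (cong (λ k → T k y m) (+-comm a b)))
                      (shiftC-shiftC b b z)) ⟩
  (T (a + a) x ⊻ T (b + a) y) ⊻ (T (b + a) y ⊻ T (b + b) z)
    ≈⟨ ⊻-cancel-middle (T (a + a) x) (T (b + a) y) (T (b + b) z) ⟩
  T (a + a) x ⊻ T (b + b) z ∎
  where
  open import Relation.Binary.Reasoning.Setoid (ℕ →-setoid Bool)
  T : ℕ → (ℕ → Bool) → ℕ → Bool
  T = shiftC

recurrence-double : ∀ {A S} → Recurrence A S → Recurrence A (2 * S)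
recurrence-double {A} {S} rec n odd m = begin
  coeff (A (n + 8 * (2 * S))) m
    ≡⟨ cong (λ i → coeff (A i) m) (index₁ n S) ⟩
  coeff (A (n + 8 * S + 8 * S)) m
    ≡⟨ shiftSum-square (8 * S) (2 * S) {x = a n} {a (n + 2 * S)} {a (n + 2 * S + 2 * S)}
                       (rec (n + 8 * S) odd₁) (rec n odd) shifted m ⟩
  shiftC (8 * S + 8 * S) (a n) m xor shiftC (2 * S + 2 * S) (a (n + 2 * S + 2 * S)) m
    ≡⟨ cong₂ _xor_ (cong (λ k → shiftC k (a n) m) (index₂ S))
                   (cong₂ (λ k i → shiftC k (a i) m) (index₃ S) (index₄ n S)) ⟩
  shiftC (8 * (2 * S)) (a n) m xor shiftC (2 * (2 * S)) (a (n + 2 * (2 * S))) m ∎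
  where
  open ≡-Reasoning
  a : ℕ → ℕ → Bool
  a i = coeff (A i)
  odd₁ : Odd (n + 8 * S)
  odd₁ = subst (λ t → Odd (n + t)) (sym (*-assoc 2 4 S)) (odd-+-even (4 * S) odd)
  index₁ : ∀ n S → n + 8 * (2 * S) ≡ n + 8 * S + 8 * S
  index₁ = solve-∀
  index₂ : ∀ S → 8 * S + 8 * S ≡ 8 * (2 * S)
  index₂ = solve-∀
  index₃ : ∀ S → 2 * S + 2 * S ≡ 2 * (2 * S)
  index₃ = solve-∀
  index₄ : ∀ n S → n + 2 * S + 2 * S ≡ n + 2 * (2 * S)
  index₄ = solve-∀
  index₅ : ∀ n S → n + 8 * S + 2 * S ≡ n + 2 * S + 8 * S
  index₅ = solve-∀
  shifted : a (n + 8 * S + 2 * S) ≗ shiftC (8 * S) (a (n + 2 * S)) ⊻ shiftC (2 * S) (a (n + 2 * S + 2 * S))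
  shifted k = trans (cong (λ i → a i k) (index₅ n S)) (rec (n + 2 * S) (odd-+-even S odd) k)

Good : (ℕ → Poly) → ℕ → Set
Good A x = SumOfPreceding (A (1 + 2 * x)) (1 + 2 * x)

good-step : ∀ {S δ A x} → Carry S δ → Recurrence A S → x < 4 * S →
  Good A x → Good A (x + S) → Good A (x + 4 * S)
good-step {S} {A = A} {x = x} carry rec x<4S good₀ good₁ k k∈
  with shiftSum-true (A (1 + 2 * x + 8 * S)) (8 * S) (A (1 + 2 * x)) (2 * S) (A (1 + 2 * x + 2 * S))
                     (rec (1 + 2 * x) (x , refl)) (subst (λ n → coeff (A n) k ≡ true) (index x S) k∈)
  where
  index : ∀ x S → 1 + 2 * (x + 4 * S) ≡ 1 + 2 * x + 8 * S
  index = solve-∀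
... | inj₁ (8S≤k , k∈₀) =
  subst (λ k' → Precedes k' _) (trans (cong (k ∸ 8 * S +_) (sym (*-assoc 2 4 S))) (m∸n+n≡m 8S≤k))
        (precedes-carry (carry-quadruple carry) x<4S (good₀ _ k∈₀))
... | inj₂ (2S≤k , k∈₁) =
  subst (λ k' → Precedes k' _) (m∸n+n≡m 2S≤k)
        (precedes-carry-quadruple carry (carry-quadruple carry) x<4S
          (good₁ _ (subst (λ n → coeff (A n) (k ∸ 2 * S) ≡ true) (sym (odd-+ x S)) k∈₁)))

dyadic-split : ∀ {s : ℕ → ℕ} → 0 < s 0 → (∀ i → s (suc i) ≡ 2 * s i) →
  ∀ m → m < s 0 ⊎ ∃₂ λ i x → m ≡ x + s i × x < s i
dyadic-split         pos doubling zero = inj₁ pos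
dyadic-split {s = s} pos doubling (suc m) with dyadic-split {s = s} pos doubling m
... | inj₁ m<s₀ with m≤n⇒m<n∨m≡n m<s₀
...   | inj₁ 1+m<s₀ = inj₁ 1+m<s₀
...   | inj₂ 1+m≡s₀ = inj₂ (0 , 0 , 1+m≡s₀ , pos)
dyadic-split {s = s} pos doubling (suc m) | inj₂ (i , x , refl , x<sᵢ) with m≤n⇒m<n∨m≡n x<sᵢ
...   | inj₁ 1+x<sᵢ = inj₂ (i , suc x , refl , 1+x<sᵢ)
...   | inj₂ 1+x≡sᵢ = inj₂ (suc i , 0 , trans (cong (_+ s i) 1+x≡sᵢ) (sym sᵢ₊₁≡) , 0<sᵢ₊₁)
  where
  sᵢ₊₁≡ : s (suc i) ≡ s i + s i
  sᵢ₊₁≡ = trans (doubling i) (cong (s i +_) (+-identityʳ (s i)))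
  0<sᵢ₊₁ : 0 < s (suc i)
  0<sᵢ₊₁ = subst (0 <_) (sym (doubling i)) (<-≤-trans (≤-<-trans z≤n x<sᵢ) (m≤m+n (s i) _))

odd-below-square : ∀ {r m} → 0 < r → m < 4 * r → 1 + 2 * m < 8 * (r * r)
odd-below-square {r} {m} 0<r m<4r = begin-strict
  1 + 2 * m    <⟨ ≤-reflexive (lemma m) ⟩
  2 * suc m    ≤⟨ *-monoʳ-≤ 2 m<4r ⟩
  2 * (4 * r)  ≡⟨ *-assoc 2 4 r ⟨
  8 * r        ≤⟨ *-monoʳ-≤ 8 (m≤m*n r r {{>-nonZero 0<r}}) ⟩
  8 * (r * r)  ∎
  where
  open ≤-Reasoning
  lemma : ∀ m → suc (1 + 2 * m) ≡ 2 * suc m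
  lemma = solve-∀

theorem3p1 : (r : ℕ) → (∃ λ j → r ≡ 2 ^ j) →
    (A : ℕ → Poly) →
    (∀ n → Odd n → InOddPart (A n)) →
    (∀ n → Odd n → IsShiftSum (A (n + 8 * r)) (8 * r) (A n) (2 * r) (A (n + 2 * r))) →
    (∀ n → Odd n → n < 8 * (r * r) → SumOfPreceding (A n) n) →
    ∀ n → Odd n → SumOfPreceding (A n) n
theorem3p1 r (j , refl) A _ rec base n (m , refl) = <-rec (Good A) good m
  where
  rec-pow : ∀ i → Recurrence A (2 ^ (i + j))
  rec-pow zero    = rec
  rec-pow (suc i) = recurrence-double {A} {2 ^ (i + j)} (rec-pow i)

  doubling : ∀ i → 4 * 2 ^ (suc i + j) ≡ 2 * (4 * 2 ^ (i + j))
  doubling i = lemma (2 ^ (i + j))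
    where
    lemma : ∀ y → 4 * (2 * y) ≡ 2 * (4 * y)
    lemma = solve-∀

  good : ∀ m → (∀ {y} → y < m → Good A y) → Good A m
  good m ih with dyadic-split {λ i → 4 * 2 ^ (i + j)} (*-monoʳ-< 4 (m^n>0 2 j)) doubling m
  ... | inj₁ m<4r = base (1 + 2 * m) (m , refl) (odd-below-square (m^n>0 2 j) m<4r)
  ... | inj₂ (i , x , refl , x<4S) =
    good-step {A = A} (proj₂ (carry-pow (i + j))) (rec-pow i) x<4S
              (ih (m<m+n x (≤-<-trans z≤n x<4S))) (ih (+-monoʳ-< x S<4S))
    where
    S<4S : 2 ^ (i + j) < 4 * 2 ^ (i + j)
    S<4S = m<m+n _ (≤-trans (m^n>0 2 (i + j)) (m≤m+n _ _))
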